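{- Let $n\geq 5$ and $1<i<j<n-1$. The complex $K^n_{i,j}=\langle [\![1,n-1]\!],[\![0,j-1]\!],[\![j+1,i-1]\!],[\![i+1,0]\!]\rangle$ on $I_n$ can be obtained from $K_5=\langle[\![0,2]\!],[\![1,3]\!],[\![2,4]\!],[\![3,1]\!]\rangle$ on $I_5$ by finitely many vertex insertions and circular permutations.
   Context: Positions $I_n=\{0,\ldots,n-1\}$ are identified with $\mathbb{Z}/n\mathbb{Z}$; for $a,b\in\mathbb{Z}$, $[\![a,b]\!]=\{c\bmod n: a\leq c\leq b'\}$ with $b'\equiv b\pmod n$, $a\leq b'<a+n$ ($n$ being the number of vertices of the ambient complex). $\langle S_0,\ldots,S_k\rangle$ is the simplicial complex whose maximal simplices are the $S_i$. A circular permutation maps a complex $K$ on $I_m$ to $\{S+c\bmod m: S\in K\}$ for some $c$. Vertex insertion: for $i\in\{0,\ldots,m\}$, $\rho^+_i:\{0,\ldots,m-1\}\to\{0,\ldots,m\}$, $\rho^+_i(j)=j$ if $j<i$ and $j+1$ if $j\geq i$; for a complex $K$ on $I_m$, $\mathrm{ins}_i(K)$ is the complex on $I_{m+1}$ whose simplices are the subsets of the sets $\rho^+_i(S)\cup\{i\}$ (if $S$ contains $(i-1)\bmod m$ or $i\bmod m$) or $\rho^+_i(S)$ (otherwise), for $S\in K$. -}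

module Defs where

open import Level using (0ℓ)
open import Data.Nat using (ℕ; zero; suc; _+_; _∸_; _≤_)
open import Data.Nat.DivMod using (_%_; _mod_)
open import Data.Fin using (Fin; toℕ; punchIn)
open import Data.Fin.Subset using (Subset; _∈_)
open import Data.List using (List; []; _∷_)
open import Data.Product using (Σ; _×_; ∃)
open import Data.Sum using (_⊎_)
open import Data.Empty using (⊥)
open import Relation.Binary.PropositionalEquality using (_≡_)

Complex : ℕ → Set₁
Complex n = Subset n → Set

_≅_ : ∀ {n} → Complex n → Complex n → Set
K ≅ L = ∀ σ → (K σ → L σ) × (L σ → K σ)

-- Cyclic interval [[a,b]] on I_n: x ∈ [[a,b]] iff (x - a) mod n ≤ (b - a) mod n.
cint : (n : ℕ) → ℕ → ℕ → Fin n → Set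
cint zero    a b x = ⊥
cint (suc k) a b x =
  ((toℕ x + (suc k ∸ a % suc k)) % suc k) ≤ ((b + (suc k ∸ a % suc k)) % suc k)

gen : ∀ {n} → List (Fin n → Set) → Complex n
gen []       σ = ⊥
gen (G ∷ Gs) σ = (∀ x → x ∈ σ → G x) ⊎ gen Gs σ

-- Circular permutation by c : {S + c mod m : S ∈ K}.
shift : ∀ {k} → ℕ → Fin (suc k) → Fin (suc k)
shift {k} c x = (toℕ x + c) mod (suc k)

rot : ∀ {k} → ℕ → Complex (suc k) → Complex (suc k)
rot c K σ = Σ _ λ S → K S ×
  (∀ y → (y ∈ σ → ∃ λ x → x ∈ S × shift c x ≡ y)
       × ((∃ λ x → x ∈ S × shift c x ≡ y) → y ∈ σ))

-- Vertex insertion ins_i for i ∈ {0,…,m}, m = suc k; ρ⁺_i is punchIn i.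
ins : ∀ {k} → Fin (suc (suc k)) → Complex (suc k) → Complex (suc (suc k))
ins {k} i K σ = Σ _ λ S → K S ×
  (∀ y → y ∈ σ →
     (∃ λ x → x ∈ S × punchIn i x ≡ y)
     ⊎ (y ≡ i × (((toℕ i + k) mod (suc k)) ∈ S ⊎ (toℕ i mod (suc k)) ∈ S)))

K5 : Complex 5
K5 = gen (cint 5 0 2 ∷ cint 5 1 3 ∷ cint 5 2 4 ∷ cint 5 3 1 ∷ [])

Knij : (n i j : ℕ) → Complex n
Knij n i j = gen (cint n 1 (n ∸ 1) ∷ cint n 0 (j ∸ 1) ∷ cint n (suc j) (i ∸ 1)
                 ∷ cint n (suc i) 0 ∷ [])

data Obtainable : (n : ℕ) → Complex n → Set₁ where
  base : Obtainable 5 K5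
  step-ins : ∀ {k K} → Obtainable (suc k) K → (i : Fin (suc (suc k))) →
             Obtainable (suc (suc k)) (ins i K)
  step-rot : ∀ {k K} → Obtainable (suc k) K → (c : ℕ) →
             Obtainable (suc k) (rot c K)

-- On vertex labels the four generators of K^n_{i,j} are the conditions x > 0, x < j,
-- (x > j or x < i) and (x > i or x < 1), which do not mention n. Since ρ⁺_q is strictly
-- increasing and misses only q, inserting a vertex at a position q with 2 ≤ q ≤ n - 1
-- replaces every threshold t of such a condition by ρ⁺_q(t), and the new vertex q meets
-- the new condition exactly when q - 1 or q met the old one. So the insertion turns
-- K^n_{i,j} into K^{n+1}_{ρ⁺_q(i),ρ⁺_q(j)}. Rotating K₅ by 3 gives K^5_{2,3};
-- from there, inserting at 2 raises i and j, inserting at j raises j, and inserting at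
-- n - 1 raises n alone, which together reach every K^n_{i,j}.
module Submission where

open import Data.Bool.Properties using (T-≡)
open import Data.Empty using (⊥-elim)
open import Data.Fin using (Fin; toℕ; punchIn; punchOut; fromℕ<)
import Data.Fin as Fin
open import Data.Fin.Properties using (toℕ<n; toℕ-fromℕ<; punchIn-punchOut; all?; any?; _≟_)
open import Data.Fin.Subset using (Subset; _∈_)
open import Data.Fin.Subset.Properties using (_∈?_)
open import Data.List using (List; []; _∷_; map)
open import Data.List.Relation.Binary.Permutation.Propositional using (_↭_; ↭-sym)
open import Data.List.Relation.Binary.Permutation.Propositional.Properties
  using (Any-resp-↭; ↭-reverse)
open import Data.List.Relation.Binary.Pointwise using (Pointwise; []; _∷_; map⁺)
import Data.List.Relation.Binary.Pointwise as Pointwise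
open import Data.List.Relation.Unary.Any using (Any; toSum; fromSum)
open import Data.Nat
  using (ℕ; zero; suc; _+_; _∸_; _≤_; _<_; _≤′_; ≤′-refl; ≤′-step; z≤n; s≤s; s≤s⁻¹; z<s; _≤?_; _<?_)
open import Data.Nat.DivMod using (_%_; _mod_; [m+n]%n≡m%n; m<n⇒m%n≡m)
open import Data.Nat.Properties
  using ( ≤-refl; ≤-trans; <-trans; ≤-<-trans; <-≤-trans; <⇒≤; <⇒≱; ≰⇒>; n≤1+n; n<1+n
        ; m≤n⇒m≤1+n; m<n⇒m<1+n; m≤m+n; m≤n+m; +-suc; +-monoˡ-≤; +-monoˡ-<; +-cancelʳ-≤
        ; m∸n≤m; ∸-monoˡ-≤; ∸-monoˡ-<; +-∸-assoc; +-∸-comm; m+[n∸m]≡n; m∸n+n≡m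
        ; m≤o∸n⇒m+n≤o; ≤′⇒≤; ≤⇒≤′ )
open import Data.Product using (Σ; ∃; _×_; _,_; proj₁; proj₂; swap)
open import Data.Sum using (_⊎_; inj₁; inj₂; [_,_])
import Data.Sum as Sum
open import Data.Sum.Function.Propositional using (_⊎-⇔_)
open import Data.Vec using (tabulate)
open import Data.Vec.Properties using (lookup∘tabulate; []=⇒lookup; lookup⇒[]=)
open import Function using (_∘_; id)
open import Function.Bundles using (_⇔_; mk⇔; Equivalence)
open import Function.Construct.Composition using (_⇔-∘_)
open import Function.Construct.Identity using (⇔-id)
open import Level using (Level)
open import Relation.Binary.PropositionalEquality
  using (_≡_; refl; sym; trans; cong; subst; subst₂; module ≡-Reasoning)
open import Relation.Nullary.Decidable
  using (Dec; yes; no; isYes; True; toWitness; fromWitness; map′; _×-dec_; _→-dec_)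
open import Relation.Unary using (Pred; Decidable; _∪_)
open import Relation.Unary.Properties using (_∪?_)

open import Defs

open Equivalence using (to; from)

private
  variable
    ℓ : Level
    k n : ℕ

≅-sym : {K L : Complex n} → K ≅ L → L ≅ K
≅-sym K≅L σ = swap (K≅L σ)

≅-trans : {K L M : Complex n} → K ≅ L → L ≅ M → K ≅ M
≅-trans K≅L L≅M σ = proj₁ (L≅M σ) ∘ proj₁ (K≅L σ) , proj₂ (K≅L σ) ∘ proj₂ (L≅M σ)

gen-cong : {Gs Hs : List (Fin n → Set)} →
           Pointwise (λ G H → ∀ x → G x ⇔ H x) Gs Hs → gen Gs ≅ gen Hs
gen-cong []           σ = id , id
gen-cong (G⇔H ∷ Gs≈Hs) σ =
  Sum.map (λ σ⊆G x → to (G⇔H x) ∘ σ⊆G x) (proj₁ (gen-cong Gs≈Hs σ)) ,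
  Sum.map (λ σ⊆H x → from (G⇔H x) ∘ σ⊆H x) (proj₂ (gen-cong Gs≈Hs σ))

gen⇔Any : (Gs : List (Fin n → Set)) (σ : Subset n) →
          gen Gs σ ⇔ Any (λ G → ∀ x → x ∈ σ → G x) Gs
gen⇔Any []       σ = mk⇔ (λ ()) (λ ())
gen⇔Any (G ∷ Gs) σ =
  mk⇔ (fromSum ∘ Sum.map₂ (to (gen⇔Any Gs σ))) (Sum.map₂ (from (gen⇔Any Gs σ)) ∘ toSum)

gen-resp-↭ : {Gs Hs : List (Fin n → Set)} → Gs ↭ Hs → gen Gs ≅ gen Hs
gen-resp-↭ {Gs = Gs} {Hs} Gs↭Hs σ =
  from (gen⇔Any Hs σ) ∘ Any-resp-↭ Gs↭Hs ∘ to (gen⇔Any Gs σ) ,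
  from (gen⇔Any Gs σ) ∘ Any-resp-↭ (↭-sym Gs↭Hs) ∘ to (gen⇔Any Hs σ)

subsetOf : {P : Pred (Fin n) ℓ} → Decidable P → Subset n
subsetOf P? = tabulate (isYes ∘ P?)

∈-subsetOf⁺ : {P : Pred (Fin n) ℓ} (P? : Decidable P) {x : Fin n} → P x → x ∈ subsetOf P?
∈-subsetOf⁺ P? {x} Px =
  lookup⇒[]= x (subsetOf P?) (trans (lookup∘tabulate _ x) (to T-≡ (fromWitness {a? = P? x} Px)))

∈-subsetOf⁻ : {P : Pred (Fin n) ℓ} (P? : Decidable P) {x : Fin n} → x ∈ subsetOf P? → P x
∈-subsetOf⁻ P? {x} x∈ =
  toWitness (from T-≡ (trans (sym (lookup∘tabulate _ x)) ([]=⇒lookup x∈)))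

[y+[n∸a]]%n≡y∸a : ∀ {a y} → a ≤ y → y < suc k → (y + (suc k ∸ a)) % suc k ≡ y ∸ a
[y+[n∸a]]%n≡y∸a {k} {a} {y} a≤y y<n = begin
  (y + (suc k ∸ a)) % suc k  ≡⟨ cong (_% suc k) (sym (+-∸-assoc y a≤n)) ⟩
  (y + suc k ∸ a) % suc k    ≡⟨ cong (_% suc k) (+-∸-comm (suc k) a≤y) ⟩
  (y ∸ a + suc k) % suc k    ≡⟨ [m+n]%n≡m%n (y ∸ a) (suc k) ⟩
  (y ∸ a) % suc k            ≡⟨ m<n⇒m%n≡m (≤-<-trans (m∸n≤m y a) y<n) ⟩
  y ∸ a                      ∎
  where
  open ≡-Reasoning
  a≤n : a ≤ suc k
  a≤n = ≤-trans a≤y (<⇒≤ y<n)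

[y+[n∸a]]%n≡y+[n∸a] : ∀ {a y} → y < a → a ≤ suc k → (y + (suc k ∸ a)) % suc k ≡ y + (suc k ∸ a)
[y+[n∸a]]%n≡y+[n∸a] {k} {a} {y} y<a a≤n =
  m<n⇒m%n≡m (subst (y + (suc k ∸ a) <_) (m+[n∸m]≡n a≤n) (+-monoˡ-< (suc k ∸ a) y<a))

cint-linear : ∀ {a b} → a ≤ b → b < suc k → (x : Fin (suc k)) →
              cint (suc k) a b x ⇔ (a ≤ toℕ x × toℕ x ≤ b)
cint-linear {k} {a} {b} a≤b b<n x
  rewrite m<n⇒m%n≡m {n = suc k} (≤-<-trans a≤b b<n) | [y+[n∸a]]%n≡y∸a a≤b b<n
  with a ≤? toℕ x
... | yes a≤x rewrite [y+[n∸a]]%n≡y∸a a≤x (toℕ<n x) =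
  mk⇔ (λ x∸a≤b∸a → a≤x , subst (_≤ b) (m∸n+n≡m a≤x) (m≤o∸n⇒m+n≤o (toℕ x ∸ a) a≤b x∸a≤b∸a))
      (∸-monoˡ-≤ a ∘ proj₂)
... | no a≰x rewrite [y+[n∸a]]%n≡y+[n∸a] (≰⇒> a≰x) (≤-trans a≤b (<⇒≤ b<n)) =
  mk⇔ (⊥-elim ∘ <⇒≱ b∸a<x+[n∸a])
      (⊥-elim ∘ a≰x ∘ proj₁)
  where
  b∸a<x+[n∸a] : b ∸ a < toℕ x + (suc k ∸ a)
  b∸a<x+[n∸a] = <-≤-trans (∸-monoˡ-< b<n a≤b) (m≤n+m (suc k ∸ a) (toℕ x))

cint-wrapped : ∀ {a b} → b < a → a < suc k → (x : Fin (suc k)) →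
               cint (suc k) a b x ⇔ (a ≤ toℕ x ⊎ toℕ x ≤ b)
cint-wrapped {k} {a} {b} b<a a<n x
  rewrite m<n⇒m%n≡m {n = suc k} a<n | [y+[n∸a]]%n≡y+[n∸a] b<a (<⇒≤ a<n)
  with a ≤? toℕ x
... | yes a≤x rewrite [y+[n∸a]]%n≡y∸a a≤x (toℕ<n x) =
  mk⇔ (λ _ → inj₁ a≤x)
      (λ _ → ≤-trans (∸-monoˡ-≤ a (<⇒≤ (toℕ<n x))) (m≤n+m (suc k ∸ a) b))
... | no a≰x rewrite [y+[n∸a]]%n≡y+[n∸a] (≰⇒> a≰x) (<⇒≤ a<n) =
  mk⇔ (inj₂ ∘ +-cancelʳ-≤ (suc k ∸ a) (toℕ x) b)
      [ ⊥-elim ∘ a≰x , +-monoˡ-≤ (suc k ∸ a) ]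

generators : ℕ → ℕ → List (ℕ → Set)
generators i j = (0 <_) ∷ (_< j) ∷ ((j <_) ∪ (_< i)) ∷ ((i <_) ∪ (_< 1)) ∷ []

Knij′ : (n i j : ℕ) → Complex n
Knij′ n i j = gen (map (_∘ toℕ) (generators i j))

m≤n⇔m<1+n : ∀ {x y} → x ≤ y ⇔ x < suc y
m≤n⇔m<1+n = mk⇔ s≤s s≤s⁻¹

Knij≅Knij′ : ∀ {m i j} → 0 < i → i ≤ j → j < m → Knij (suc m) i j ≅ Knij′ (suc m) i j
Knij≅Knij′ {m} {suc i} {suc j} z<s (s≤s i≤j) j<m = gen-cong (A ∷ B ∷ C ∷ D ∷ [])
  where
  A : ∀ x → cint (suc m) 1 m x ⇔ 0 < toℕ x
  A x = mk⇔ proj₁ (_, s≤s⁻¹ (toℕ<n x)) ⇔-∘ cint-linear (≤-trans (s≤s z≤n) j<m) ≤-refl x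
  B : ∀ x → cint (suc m) 0 j x ⇔ toℕ x < suc j
  B x = mk⇔ (s≤s ∘ proj₂) ((z≤n ,_) ∘ s≤s⁻¹) ⇔-∘ cint-linear z≤n (m<n⇒m<1+n (<⇒≤ j<m)) x
  C : ∀ x → cint (suc m) (suc (suc j)) i x ⇔ (suc j < toℕ x ⊎ toℕ x < suc i)
  C x = (⇔-id _ ⊎-⇔ m≤n⇔m<1+n) ⇔-∘ cint-wrapped (s≤s (≤-trans i≤j (n≤1+n j))) (s≤s j<m) x
  D : ∀ x → cint (suc m) (suc (suc i)) 0 x ⇔ (suc i < toℕ x ⊎ toℕ x < 1)
  D x = (⇔-id _ ⊎-⇔ m≤n⇔m<1+n) ⇔-∘ cint-wrapped (s≤s z≤n) (s≤s (≤-<-trans (s≤s i≤j) j<m)) x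

ρ⁺ : ℕ → ℕ → ℕ
ρ⁺ zero    x       = suc x
ρ⁺ (suc q) zero    = zero
ρ⁺ (suc q) (suc x) = suc (ρ⁺ q x)

toℕ-punchIn : (p : Fin (suc n)) (x : Fin n) → toℕ (punchIn p x) ≡ ρ⁺ (toℕ p) (toℕ x)
toℕ-punchIn Fin.zero    x           = refl
toℕ-punchIn (Fin.suc p) Fin.zero    = refl
toℕ-punchIn (Fin.suc p) (Fin.suc x) = cong suc (toℕ-punchIn p x)

ρ⁺-< : ∀ {q x} → x < q → ρ⁺ q x ≡ x
ρ⁺-< {suc q} {zero}  _         = refl
ρ⁺-< {suc q} {suc x} (s≤s x<q) = cong suc (ρ⁺-< x<q)

ρ⁺-≥ : ∀ {q x} → q ≤ x → ρ⁺ q x ≡ suc x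
ρ⁺-≥ {zero}            _         = refl
ρ⁺-≥ {suc q} {suc x} (s≤s q≤x) = cong suc (ρ⁺-≥ q≤x)

ρ⁺-mono-< : ∀ q {x y} → x < y → ρ⁺ q x < ρ⁺ q y
ρ⁺-mono-< zero                  x<y       = s≤s x<y
ρ⁺-mono-< (suc q) {zero} {suc y} _         = s≤s z≤n
ρ⁺-mono-< (suc q) {suc x} {suc y} (s≤s x<y) = s≤s (ρ⁺-mono-< q x<y)

ρ⁺-cancel-< : ∀ q {x y} → ρ⁺ q x < ρ⁺ q y → x < y
ρ⁺-cancel-< zero                    ρx<ρy       = s≤s⁻¹ ρx<ρy
ρ⁺-cancel-< (suc q) {zero}  {suc y} _           = s≤s z≤n
ρ⁺-cancel-< (suc q) {suc x} {suc y} (s≤s ρx<ρy) = s≤s (ρ⁺-cancel-< q ρx<ρy)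

s≤s-⇔ : ∀ {a b c d} → a ≤ b ⇔ c ≤ d → suc a ≤ suc b ⇔ suc c ≤ suc d
s≤s-⇔ a≤b⇔c≤d = mk⇔ (s≤s ∘ to a≤b⇔c≤d ∘ s≤s⁻¹) (s≤s ∘ from a≤b⇔c≤d ∘ s≤s⁻¹)

ρ⁺qt<q⇔t<q : ∀ q t → ρ⁺ q t < q ⇔ t < q
ρ⁺qt<q⇔t<q zero    t       = mk⇔ (λ ()) (λ ())
ρ⁺qt<q⇔t<q (suc q) zero    = ⇔-id _
ρ⁺qt<q⇔t<q (suc q) (suc t) = s≤s-⇔ (ρ⁺qt<q⇔t<q q t)

q<ρ⁺qt⇔q≤t : ∀ q t → q < ρ⁺ q t ⇔ q ≤ t
q<ρ⁺qt⇔q≤t zero    t       = mk⇔ (λ _ → z≤n) (λ _ → s≤s z≤n)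
q<ρ⁺qt⇔q≤t (suc q) zero    = mk⇔ (λ ()) (λ ())
q<ρ⁺qt⇔q≤t (suc q) (suc t) = s≤s-⇔ (q<ρ⁺qt⇔q≤t q t)

-- P′ describes, on the labels 0 … m, the generator obtained from the generator
-- described by P on 0 … m - 1 by inserting a vertex at position q.
record InsertionCompatible (q : ℕ) (P P′ : ℕ → Set) : Set where
  field
    decidable : Decidable P
    at-old    : ∀ x → P′ (ρ⁺ q x) ⇔ P x
    at-new    : P′ q ⇔ (P (q ∸ 1) ⊎ P q)

above-compatible : ∀ q t → InsertionCompatible q (t <_) (ρ⁺ q t <_)
above-compatible q t = record
  { decidable = t <?_
  ; at-old    = λ _ → mk⇔ (ρ⁺-cancel-< q) (ρ⁺-mono-< q)
  ; at-new    = mk⇔ inj₂ [ (λ t<q∸1 → <-≤-trans t<q∸1 (m∸n≤m q 1)) , id ] ⇔-∘ ρ⁺qt<q⇔t<q q t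
  }

below-compatible : ∀ q t → 0 < q → InsertionCompatible q (_< t) (_< ρ⁺ q t)
below-compatible (suc q) t _ = record
  { decidable = _<? t
  ; at-old    = λ _ → mk⇔ (ρ⁺-cancel-< (suc q)) (ρ⁺-mono-< (suc q))
  ; at-new    = mk⇔ inj₁ [ id , <⇒≤ ] ⇔-∘ q<ρ⁺qt⇔q≤t (suc q) t
  }

⊎-interchange : ∀ {A B C D : Set} → ((A ⊎ B) ⊎ (C ⊎ D)) ⇔ ((A ⊎ C) ⊎ (B ⊎ D))
⊎-interchange = mk⇔ [ Sum.map inj₁ inj₁ , Sum.map inj₂ inj₂ ] [ Sum.map inj₁ inj₁ , Sum.map inj₂ inj₂ ]

∪-compatible : ∀ {q P P′ R R′} → InsertionCompatible q P P′ → InsertionCompatible q R R′ →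
               InsertionCompatible q (P ∪ R) (P′ ∪ R′)
∪-compatible P↝P′ R↝R′ = record
  { decidable = P.decidable ∪? R.decidable
  ; at-old    = λ x → P.at-old x ⊎-⇔ R.at-old x
  ; at-new    = ⊎-interchange ⇔-∘ (P.at-new ⊎-⇔ R.at-new)
  }
  where
  module P = InsertionCompatible P↝P′
  module R = InsertionCompatible R↝R′

generators-compatible : ∀ {q i j} → 2 ≤ q →
  Pointwise (InsertionCompatible q) (generators i j) (generators (ρ⁺ q i) (ρ⁺ q j))
-- Matching q ≥ 2 makes ρ⁺ q 0 and ρ⁺ q 1 reduce to 0 and 1.
generators-compatible {q} {i} {j} (s≤s (s≤s _)) =
  above-compatible q 0 ∷
  below-compatible q j z<s ∷
  ∪-compatible (above-compatible q j) (below-compatible q i z<s) ∷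
  ∪-compatible (above-compatible q i) (below-compatible q 1 z<s) ∷ []

-- H is the image of G under ins p; as in ins, p - 1 and p are read modulo the old
-- number of vertices.
record InsertedGenerator (p : Fin (suc (suc k)))
                         (G : Fin (suc k) → Set) (H : Fin (suc (suc k)) → Set) : Set where
  field
    decidable : Decidable G
    at-old    : ∀ x → H (punchIn p x) ⇔ G x
    at-new    : H p ⇔ (G ((toℕ p + k) mod suc k) ⊎ G (toℕ p mod suc k))

Covers : Fin (suc (suc k)) → Subset (suc (suc k)) → Subset (suc k) → Set
Covers {k} p σ S = ∀ y → y ∈ σ →
  (∃ λ x → x ∈ S × punchIn p x ≡ y) ⊎ (y ≡ p × ((toℕ p + k) mod suc k ∈ S ⊎ toℕ p mod suc k ∈ S))

ins-cong : (p : Fin (suc (suc k))) {K L : Complex (suc k)} → K ≅ L → ins p K ≅ ins p L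
ins-cong p K≅L σ = (λ { (S , KS , cover) → S , proj₁ (K≅L S) KS , cover })
                 , (λ { (S , LS , cover) → S , proj₂ (K≅L S) LS , cover })

module _ (p : Fin (suc (suc k))) where

  ins-gen⇒ : ∀ {Gs Hs σ} → Pointwise (InsertedGenerator p) Gs Hs → ins p (gen Gs) σ → gen Hs σ
  ins-gen⇒ {Hs = H ∷ _} {σ} (G↝H ∷ _) (S , inj₁ S⊆G , cover) = inj₁ σ⊆H
    where
    open InsertedGenerator G↝H
    σ⊆H : ∀ y → y ∈ σ → H y
    σ⊆H y y∈σ with cover y y∈σ
    ... | inj₁ (x , x∈S , refl)     = from (at-old x) (S⊆G x x∈S)
    ... | inj₂ (refl , inj₁ p-1∈S) = from at-new (inj₁ (S⊆G _ p-1∈S))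
    ... | inj₂ (refl , inj₂ p∈S)   = from at-new (inj₂ (S⊆G _ p∈S))
  ins-gen⇒ (_ ∷ Gs↝Hs) (S , inj₂ GsS , cover) = inj₂ (ins-gen⇒ Gs↝Hs (S , GsS , cover))

  ins-gen⇐ : ∀ {Gs Hs σ} → Pointwise (InsertedGenerator p) Gs Hs → gen Hs σ → ins p (gen Gs) σ
  ins-gen⇐ {Hs = H ∷ _} {σ} (G↝H ∷ _) (inj₁ σ⊆H) = S , inj₁ (λ _ → ∈-subsetOf⁻ decidable) , cover
    where
    open InsertedGenerator G↝H
    S : Subset (suc k)
    S = subsetOf decidable
    cover : Covers p σ S
    cover y y∈σ with p ≟ y
    ... | yes refl = inj₂ (refl , Sum.map (∈-subsetOf⁺ decidable) (∈-subsetOf⁺ decidable)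
                                          (to at-new (σ⊆H p y∈σ)))
    ... | no p≢y   = inj₁ (x , ∈-subsetOf⁺ decidable (to (at-old x) Hx) , punchIn-punchOut p≢y)
      where
      x : Fin (suc k)
      x = punchOut p≢y
      Hx : H (punchIn p x)
      Hx = subst H (sym (punchIn-punchOut p≢y)) (σ⊆H y y∈σ)
  ins-gen⇐ (_ ∷ Gs↝Hs) (inj₂ GsH) with ins-gen⇐ Gs↝Hs GsH
  ... | S , GsS , cover = S , inj₂ GsS , cover

  ins-gen : ∀ {Gs Hs} → Pointwise (InsertedGenerator p) Gs Hs → ins p (gen Gs) ≅ gen Hs
  ins-gen Gs↝Hs σ = ins-gen⇒ Gs↝Hs , ins-gen⇐ Gs↝Hs

[q+k]%[1+k]≡q∸1 : ∀ {q} → 0 < q → q ≤ suc k → (q + k) % suc k ≡ q ∸ 1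
[q+k]%[1+k]≡q∸1 {k} {suc q} _ q<1+k = begin
  (suc q + k) % suc k  ≡⟨ cong (_% suc k) (sym (+-suc q k)) ⟩
  (q + suc k) % suc k  ≡⟨ [m+n]%n≡m%n q (suc k) ⟩
  q % suc k            ≡⟨ m<n⇒m%n≡m q<1+k ⟩
  q                    ∎
  where open ≡-Reasoning

compatible⇒inserted : ∀ {P P′} (p : Fin (suc (suc k))) → 0 < toℕ p → toℕ p ≤ k →
                 InsertionCompatible (toℕ p) P P′ → InsertedGenerator p (P ∘ toℕ) (P′ ∘ toℕ)
compatible⇒inserted {k} {P} {P′} p 0<p p≤k P↝P′ = record
  { decidable = decidable ∘ toℕ
  ; at-old    = λ x → subst (λ y → P′ y ⇔ P (toℕ x)) (sym (toℕ-punchIn p x)) (at-old (toℕ x))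
  ; at-new    = subst₂ (λ l r → P′ (toℕ p) ⇔ (P l ⊎ P r)) (sym toℕ-left) (sym toℕ-right) at-new
  }
  where
  open InsertionCompatible P↝P′
  toℕ-left : toℕ ((toℕ p + k) mod suc k) ≡ toℕ p ∸ 1
  toℕ-left = trans (toℕ-fromℕ< _) ([q+k]%[1+k]≡q∸1 0<p (s≤s⁻¹ (toℕ<n p)))
  toℕ-right : toℕ (toℕ p mod suc k) ≡ toℕ p
  toℕ-right = trans (toℕ-fromℕ< _) (m<n⇒m%n≡m (s≤s p≤k))

ins-Knij′ : ∀ {i j q} (p : Fin (suc (suc k))) → toℕ p ≡ q → 2 ≤ q → q ≤ k →
            ins p (Knij′ (suc k) i j) ≅ Knij′ (suc (suc k)) (ρ⁺ q i) (ρ⁺ q j)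
ins-Knij′ p refl 2≤q q≤k =
  ins-gen p (map⁺ _ _ (Pointwise.map (compatible⇒inserted p (≤-trans (s≤s z≤n) 2≤q) q≤k)
                                     (generators-compatible 2≤q)))

Obtainable≅ : (n : ℕ) → Complex n → Set₁
Obtainable≅ n L = Σ (Complex n) λ K → Obtainable n K × K ≅ L

insert-vertex : ∀ {i j i′ j′} q → 2 ≤ q → q ≤ k → ρ⁺ q i ≡ i′ → ρ⁺ q j ≡ j′ →
                Obtainable≅ (suc k) (Knij′ (suc k) i j) →
                Obtainable≅ (suc (suc k)) (Knij′ (suc (suc k)) i′ j′)
insert-vertex {k} q 2≤q q≤k refl refl (K , K-obtainable , K≅) =
  ins p K , step-ins K-obtainable p , ≅-trans (ins-cong p K≅) (ins-Knij′ p (toℕ-fromℕ< q<) 2≤q q≤k)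
  where
  q< : q < suc (suc k)
  q< = s≤s (m≤n⇒m≤1+n q≤k)
  p : Fin (suc (suc k))
  p = fromℕ< q<

Obtainable≅-resp-≅ : {L M : Complex n} → L ≅ M → Obtainable≅ n L → Obtainable≅ n M
Obtainable≅-resp-≅ L≅M (K , K-obtainable , K≅L) = K , K-obtainable , ≅-trans K≅L L≅M

module _ {k : ℕ} (c : ℕ) where

  rot-gen⇒ : ∀ {Gs Hs : List (Fin (suc k) → Set)} {σ} →
             Pointwise (λ G H → ∀ x → H (shift c x) ⇔ G x) Gs Hs → rot c (gen Gs) σ → gen Hs σ
  rot-gen⇒ {Hs = H ∷ _} {σ} (G≈H ∷ _) (S , inj₁ S⊆G , image) = inj₁ σ⊆H
    where
    σ⊆H : ∀ y → y ∈ σ → H y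
    σ⊆H y y∈σ with proj₁ (image y) y∈σ
    ... | x , x∈S , refl = from (G≈H x) (S⊆G x x∈S)
  rot-gen⇒ (_ ∷ Gs≈Hs) (S , inj₂ GsS , image) = inj₂ (rot-gen⇒ Gs≈Hs (S , GsS , image))

  rot-gen⇐ : ∀ {Gs Hs : List (Fin (suc k) → Set)} {σ} → (∀ (y : Fin (suc k)) → ∃ λ x → shift c x ≡ y) →
             Pointwise (λ G H → ∀ x → H (shift c x) ⇔ G x) Gs Hs → gen Hs σ → rot c (gen Gs) σ
  rot-gen⇐ {σ = σ} surjective (G≈H ∷ _) (inj₁ σ⊆H) =
    S , inj₁ (λ x x∈S → to (G≈H x) (σ⊆H _ (∈-subsetOf⁻ shifted∈σ? x∈S))) , image
    where
    shifted∈σ? : Decidable (λ x → shift c x ∈ σ)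
    shifted∈σ? x = shift c x ∈? σ
    S : Subset (suc k)
    S = subsetOf shifted∈σ?
    image : ∀ y → (y ∈ σ → ∃ λ x → x ∈ S × shift c x ≡ y) × ((∃ λ x → x ∈ S × shift c x ≡ y) → y ∈ σ)
    image y = (λ y∈σ → let x , x↦y = surjective y in
                       x , ∈-subsetOf⁺ shifted∈σ? (subst (_∈ σ) (sym x↦y) y∈σ) , x↦y)
            , (λ { (x , x∈S , refl) → ∈-subsetOf⁻ shifted∈σ? x∈S })
  rot-gen⇐ surjective (_ ∷ Gs≈Hs) (inj₂ GsH) with rot-gen⇐ surjective Gs≈Hs GsH
  ... | S , GsS , image = S , inj₂ GsS , image

  rot-gen : ∀ {Gs Hs : List (Fin (suc k) → Set)} → (∀ (y : Fin (suc k)) → ∃ λ x → shift c x ≡ y) →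
            Pointwise (λ G H → ∀ x → H (shift c x) ⇔ G x) Gs Hs → rot c (gen Gs) ≅ gen Hs
  rot-gen surjective Gs≈Hs σ = rot-gen⇒ Gs≈Hs , rot-gen⇐ surjective Gs≈Hs

_⇔-dec_ : ∀ {A B : Set} → Dec A → Dec B → Dec (A ⇔ B)
a? ⇔-dec b? = map′ (λ (f , g) → mk⇔ f g) (λ A⇔B → to A⇔B , from A⇔B) ((a? →-dec b?) ×-dec (b? →-dec a?))

cint? : ∀ n a b → Decidable (cint n a b)
cint? (suc k) a b x = _ ≤? _

cint-rotation : ∀ c a b a′ b′ →
  {True (all? λ x → cint? (suc k) a′ b′ (shift c x) ⇔-dec cint? (suc k) a b x)} →
  ∀ x → cint (suc k) a′ b′ (shift c x) ⇔ cint (suc k) a b x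
cint-rotation c a b a′ b′ {decided} = toWitness decided

-- Rotation by 3 sends the generators of K₅ to those of K^5_{2,3}, listed in reverse order.
K5-rotated : Pointwise (λ G H → ∀ x → H (shift 3 x) ⇔ G x)
  (cint 5 0 2 ∷ cint 5 1 3 ∷ cint 5 2 4 ∷ cint 5 3 1 ∷ [])
  (cint 5 3 0 ∷ cint 5 4 1 ∷ cint 5 0 2 ∷ cint 5 1 4 ∷ [])
K5-rotated = cint-rotation 3 0 2 3 0 ∷ cint-rotation 3 1 3 4 1 ∷
             cint-rotation 3 2 4 0 2 ∷ cint-rotation 3 3 1 1 4 ∷ []

shift-3-surjective : ∀ (y : Fin 5) → ∃ λ x → shift 3 x ≡ y
shift-3-surjective = toWitness {a? = all? λ y → any? λ x → shift 3 x ≟ y} _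

Knij′-5-2-3 : Obtainable≅ 5 (Knij′ 5 2 3)
Knij′-5-2-3 = rot 3 K5 , step-rot base 3 ,
  ≅-trans (rot-gen 3 shift-3-surjective K5-rotated)
  (≅-trans (gen-resp-↭ (↭-reverse _)) (Knij≅Knij′ z<s (n≤1+n 2) (n<1+n 3)))

extend-ij : ∀ {i} → 2 ≤′ i → Obtainable≅ (3 + i) (Knij′ (3 + i) i (suc i))
extend-ij ≤′-refl                = Knij′-5-2-3
extend-ij (≤′-step {i} 2≤′i) =
  insert-vertex 2 ≤-refl (m≤m+n 2 i) (ρ⁺-≥ 2≤i) (ρ⁺-≥ (m≤n⇒m≤1+n 2≤i)) (extend-ij 2≤′i)
  where
  2≤i : 2 ≤ i
  2≤i = ≤′⇒≤ 2≤′i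

extend-j : ∀ {i j₀ j} → i < j₀ → 2 ≤ j₀ → j₀ ≤′ j →
           Obtainable≅ (2 + j₀) (Knij′ (2 + j₀) i j₀) → Obtainable≅ (2 + j) (Knij′ (2 + j) i j)
extend-j i<j₀ 2≤j₀ ≤′-refl                K = K
extend-j {j₀ = j₀} i<j₀ 2≤j₀ (≤′-step {j} j₀≤′j) K =
  insert-vertex j (≤-trans 2≤j₀ j₀≤j) (n≤1+n j) (ρ⁺-< (<-≤-trans i<j₀ j₀≤j)) (ρ⁺-≥ ≤-refl)
                (extend-j i<j₀ 2≤j₀ j₀≤′j K)
  where
  j₀≤j : j₀ ≤ j
  j₀≤j = ≤′⇒≤ j₀≤′j

extend-n : ∀ {i j m₀ m} → i < m₀ → j < m₀ → 2 ≤ m₀ → m₀ ≤′ m →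
           Obtainable≅ (suc m₀) (Knij′ (suc m₀) i j) → Obtainable≅ (suc m) (Knij′ (suc m) i j)
extend-n i<m₀ j<m₀ 2≤m₀ ≤′-refl                K = K
extend-n {m₀ = m₀} i<m₀ j<m₀ 2≤m₀ (≤′-step {m} m₀≤′m) K =
  insert-vertex m (≤-trans 2≤m₀ m₀≤m) ≤-refl (ρ⁺-< (<-≤-trans i<m₀ m₀≤m)) (ρ⁺-< (<-≤-trans j<m₀ m₀≤m))
                (extend-n i<m₀ j<m₀ 2≤m₀ m₀≤′m K)
  where
  m₀≤m : m₀ ≤ m
  m₀≤m = ≤′⇒≤ m₀≤′m

proposition6p5 : (n i j : ℕ) → 5 ≤ n → 1 < i → i < j → j < n ∸ 1 →
    Σ (Complex n) λ K → Obtainable n K × (K ≅ Knij n i j)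
-- n ≥ 5 is implied by the other hypotheses.
proposition6p5 zero    i j _ _   _   ()
proposition6p5 (suc m) i j _ 1<i i<j j<m =
  Obtainable≅-resp-≅ (≅-sym (Knij≅Knij′ (<-trans z<s 1<i) (<⇒≤ i<j) j<m))
    (extend-n (m<n⇒m<1+n i<j) (n<1+n j) (m≤n⇒m≤1+n 2≤j) (≤⇒≤′ j<m)
      (extend-j (n<1+n i) (m≤n⇒m≤1+n 1<i) (≤⇒≤′ i<j)
        (extend-ij (≤⇒≤′ 1<i))))
  where
  2≤j : 2 ≤ j
  2≤j = ≤-trans 1<i (<⇒≤ i<j)
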